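{- Let $L_1$ and $L_2$ be regular languages. Then $GSA(L_1,L_2)$ is a regular language.
   Context: For words $w_1,w_2$ and a nonempty word $x$ that is a substring of both, $GSA_x(w_1,w_2)=\{u_1xv_1,u_2xv_2,u_1xv_2,u_2xv_1 : w_1=u_1xv_1,\ w_2=u_2xv_2\}$ over all such factorizations; $GSA(w_1,w_2)=\bigcup_x GSA_x(w_1,w_2)$ over all nonempty common substrings $x$; and $GSA(L_1,L_2)=\bigcup_{w_1\in L_1,w_2\in L_2}GSA(w_1,w_2)$. -}

module Defs where

open import Data.Nat using (ℕ)
open import Data.Fin using (Fin)
open import Data.Bool using (Bool; true)
open import Data.List using (List; []; _∷_; _++_)
open import Data.Product using (Σ; ∃; _×_; _,_)
open import Data.Sum using (_⊎_)
open import Relation.Binary.PropositionalEquality using (_≡_; _≢_)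
open import Function.Bundles using (_⇔_)

Language : Set → Set₁
Language A = List A → Set

record DFA (A : Set) : Set where
  field
    size   : ℕ
    start  : Fin size
    δ      : Fin size → A → Fin size
    final  : Fin size → Bool

  run : Fin size → List A → Fin size
  run q []      = q
  run q (a ∷ w) = run (δ q a) w

  Accepts : List A → Set
  Accepts w = final (run start w) ≡ true

Regular : {A : Set} → Language A → Set
Regular {A} L = Σ (DFA A) λ D → (w : List A) → L w ⇔ DFA.Accepts D w

GSAWord : {A : Set} → List A → List A → List A → Set
GSAWord {A} w₁ w₂ w =
  ∃ λ (u₁ : List A) → ∃ λ (x : List A) → ∃ λ (v₁ : List A) →
  ∃ λ (u₂ : List A) → ∃ λ (v₂ : List A) →
    x ≢ [] × w₁ ≡ u₁ ++ x ++ v₁ × w₂ ≡ u₂ ++ x ++ v₂ ×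
    (w ≡ u₁ ++ x ++ v₁ ⊎ w ≡ u₂ ++ x ++ v₂ ⊎ w ≡ u₁ ++ x ++ v₂ ⊎ w ≡ u₂ ++ x ++ v₁)

GSA : {A : Set} → Language A → Language A → Language A
GSA {A} L₁ L₂ w = ∃ λ (w₁ : List A) → ∃ λ (w₂ : List A) → L₁ w₁ × L₂ w₂ × GSAWord w₁ w₂ w

-- The key observation is that a nonempty common factor x may always be shrunk
-- to its first letter a: splicing along x is the same as splicing along a.
-- Hence a word w belongs to GSA(L₁, L₂) exactly when
--   (1) w ∈ L₁ and w contains a letter occurring in some word of L₂, or
--   (2) the same with L₁ and L₂ exchanged, or
--   (3) w = u a v with u a a prefix of a word of L₁ and a v a suffix of a
--       word of L₂ (the language Cross L₁ L₂), or
--   (4) the same with L₁ and L₂ exchanged.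
-- We work with automata over an arbitrary finite state set (a retract of some
-- Fin n), which are converted to the DFAs of Defs at the very end.  Such
-- automata are closed under Boolean combinations (product construction);
-- reachability in them is decidable (pigeonhole: short witnesses suffice),
-- which makes "a occurs in L" decidable and hence (1), (2) recognisable; and
-- Cross L₁ L₂ is recognised by running L₁'s automaton together with the set
-- of L₂-states still pending from a guessed splice point.
module Submission where

open import Defs
open import Data.Nat using (ℕ; zero; suc; _+_; _∸_; _≤_; _<_; z≤n; s≤s; _⊓_; _≤?_)
open import Data.Nat.Properties
  using (≤-refl; ≤-trans; <⇒≤; ≰⇒>; <-≤-trans; <⇒≤pred; n<1+n; m⊓n≤m; m+[n∸m]≡n; +-monoˡ-≤; +-monoˡ-<; module ≤-Reasoning)
open import Data.Fin using (Fin; zero; toℕ)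
open import Data.Fin.Properties using (pigeonhole; toℕ≤pred[n]; any?; *↔×; 2↔Bool)
import Data.Fin.Properties as Fin
open import Data.Bool using (Bool; true; false; T; _∨_)
open import Data.Bool.Properties using (T-≡; T-∨)
import Data.Bool.Properties as Bool
open import Data.Vec using (Vec; []; _∷_; lookup; tabulate)
open import Data.Vec.Properties using (lookup∘tabulate)
open import Data.List using (List; []; _∷_; _++_; length; take; drop; foldl)
open import Data.List.Properties using (foldl-++; length-++; length-take; length-drop; take++drop≡id)
open import Data.Product using (Σ; ∃; _×_; _,_; proj₁; proj₂)
open import Data.Product.Function.NonDependent.Propositional using (_×-⇔_; _×-↩_)
open import Data.Sum using (_⊎_; inj₁; inj₂; [_,_])
open import Data.Sum.Function.Propositional using (_⊎-⇔_)
open import Data.Empty using (⊥; ⊥-elim)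
open import Relation.Nullary using (Dec; yes; no)
open import Relation.Nullary.Decidable using (isYes; toWitness; fromWitness; map′; _×-dec_; _⊎-dec_; T?)
open import Relation.Unary using (Decidable)
open import Relation.Binary.PropositionalEquality using (_≡_; refl; sym; trans; cong; cong₂; subst; module ≡-Reasoning)
open import Function using (id)
open import Function.Bundles using (_⇔_; mk⇔; Equivalence; _↩_; mk↩; LeftInverse)
open Equivalence using (to; from)
open import Function.Properties.Equivalence using () renaming (refl to ⇔-refl; sym to ⇔-sym; trans to ⇔-trans)
open import Function.Properties.Inverse using (↔⇒↩)
open import Function.Construct.Composition using (_↩-∘_)
open import Function.Construct.Identity using (↩-id)

variable
  A S S′ : Set
  L L′ L₁ L₂ : Language A

Finite : Set → Set
Finite S = ∃ λ n → Fin n ↩ S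

module FiniteSet (fin : Finite S) where

  size : ℕ
  size = proj₁ fin

  code : S → Fin size
  code = LeftInverse.from (proj₂ fin)

  decode : Fin size → S
  decode = LeftInverse.to (proj₂ fin)

  decode-code : ∀ s → decode (code s) ≡ s
  decode-code = LeftInverse.strictlyInverseˡ (proj₂ fin)

  code-injective : ∀ {s t} → code s ≡ code t → s ≡ t
  code-injective {s} {t} same = trans (sym (decode-code s)) (trans (cong decode same) (decode-code t))

  _≟_ : (s t : S) → Dec (s ≡ t)
  s ≟ t = map′ code-injective (cong code) (code s Fin.≟ code t)

  ∃? : {P : S → Set} → Decidable P → Dec (∃ P)
  ∃? {P} P? = map′ (λ (i , p) → decode i , p) (λ (s , p) → code s , subst P (sym (decode-code s)) p)
                   (any? (λ i → P? (decode i)))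

finite-Fin : ∀ n → Finite (Fin n)
finite-Fin n = n , ↩-id (Fin n)

finite-Bool : Finite Bool
finite-Bool = 2 , ↔⇒↩ 2↔Bool

finite-× : Finite S → Finite S′ → Finite (S × S′)
finite-× (m , f) (n , g) = _ , (f ×-↩ g) ↩-∘ ↔⇒↩ (*↔× {m} {n})

finite-Vec : Finite S → ∀ n → Finite (Vec S n)
finite-Vec {S} fin zero = 1 , mk↩ {to = λ _ → []} {from = λ _ → zero} λ { {[]} _ → refl }
finite-Vec {S} fin (suc n) = _ , cons ↩-∘ proj₂ (finite-× fin (finite-Vec fin n))
  where
    cons : (S × Vec S n) ↩ Vec S (suc n)
    cons = mk↩ {to = λ (x , xs) → x ∷ xs} {from = λ { (x ∷ xs) → x , xs }} λ { {_ ∷ _} refl → refl }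

record Automaton (A : Set) : Set₁ where
  field
    State  : Set
    finite : Finite State
    start  : State
    step   : State → A → State
    Final  : State → Set
    final? : Decidable Final

  run : State → List A → State
  run = foldl step

  From : State → Language A
  From s w = Final (run s w)

  From-++ : ∀ s u v → From s (u ++ v) ⇔ From (run s u) v
  From-++ s u v = mk⇔ (subst Final (foldl-++ step s u v)) (subst Final (sym (foldl-++ step s u v)))

Recognisable : Language A → Set₁
Recognisable {A} L = Σ (Automaton A) λ M → ∀ w → L w ⇔ Automaton.From M (Automaton.start M) w

characterise : (M : Automaton A) (Sem : Automaton.State M → Language A) →
               (∀ s → Sem s [] ⇔ Automaton.Final M s) →
               (∀ s a w → Sem s (a ∷ w) ⇔ Sem (Automaton.step M s a) w) →
               ∀ s w → Sem s w ⇔ Automaton.From M s w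
characterise M Sem base step s []      = base s
characterise M Sem base step s (a ∷ w) = ⇔-trans (step s a w) (characterise M Sem base step _ w)

recognisable-⇔ : (∀ w → L w ⇔ L′ w) → Recognisable L → Recognisable L′
recognisable-⇔ L⇔L′ (M , L⇔M) = M , λ w → ⇔-trans (⇔-sym (L⇔L′ w)) (L⇔M w)

regular⇒recognisable : Regular L → Recognisable L
regular⇒recognisable {A} (D , L⇔D) = M , λ w → ⇔-trans (L⇔D w) (accepts w)
  where
    open DFA D
    M : Automaton A
    M = record { State = Fin size ; finite = finite-Fin size ; start = start ; step = δ
               ; Final = λ q → final q ≡ true ; final? = λ q → final q Bool.≟ true }

    run-foldl : ∀ q w → run q w ≡ foldl δ q w
    run-foldl q []      = refl
    run-foldl q (a ∷ w) = run-foldl (δ q a) w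

    accepts : ∀ w → Accepts w ⇔ Automaton.From M start w
    accepts w rewrite run-foldl start w = ⇔-refl

recognisable⇒regular : Recognisable L → Regular L
recognisable⇒regular {A} (M , L⇔M) = D , λ w → ⇔-trans (L⇔M w) (accepts w)
  where
    open Automaton M
    open FiniteSet finite
    D : DFA A
    D = record { size = size ; start = code start ; δ = λ i a → code (step (decode i) a)
               ; final = λ i → isYes (final? (decode i)) }

    run-code : ∀ s w → DFA.run D (code s) w ≡ code (run s w)
    run-code s []      = refl
    run-code s (a ∷ w) rewrite decode-code s = run-code (step s a) w

    accepts : ∀ w → From start w ⇔ DFA.Accepts D w
    accepts w rewrite run-code start w | decode-code (run start w) = ⇔-trans (mk⇔ fromWitness toWitness) T-≡

recognisable-product : {_⊕_ : Set → Set → Set} →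
                       (∀ {P Q} → Dec P → Dec Q → Dec (P ⊕ Q)) →
                       (∀ {P P′ Q Q′} → P ⇔ P′ → Q ⇔ Q′ → (P ⊕ Q) ⇔ (P′ ⊕ Q′)) →
                       Recognisable L₁ → Recognisable L₂ → Recognisable (λ w → L₁ w ⊕ L₂ w)
recognisable-product {A} {_⊕_ = _⊕_} _⊕?_ ⊕-cong (M , L₁⇔M) (N , L₂⇔N) =
  P , λ w → ⇔-trans (⊕-cong (L₁⇔M w) (L₂⇔N w)) (parallel (M.start , N.start) w)
  where
    module M = Automaton M
    module N = Automaton N
    P : Automaton A
    P = record { State = M.State × N.State ; finite = finite-× M.finite N.finite
               ; start = M.start , N.start
               ; step = λ st a → M.step (proj₁ st) a , N.step (proj₂ st) a
               ; Final = λ st → M.Final (proj₁ st) ⊕ N.Final (proj₂ st)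
               ; final? = λ st → M.final? (proj₁ st) ⊕? N.final? (proj₂ st) }

    parallel : ∀ st w → (M.From (proj₁ st) w ⊕ N.From (proj₂ st) w) ⇔ Automaton.From P st w
    parallel = characterise P (λ st w → M.From (proj₁ st) w ⊕ N.From (proj₂ st) w)
                              (λ _ → ⇔-refl) (λ _ _ _ → ⇔-refl)

recognisable-∪ : Recognisable L₁ → Recognisable L₂ → Recognisable (λ w → L₁ w ⊎ L₂ w)
recognisable-∪ = recognisable-product _⊎-dec_ _⊎-⇔_

recognisable-∩ : Recognisable L₁ → Recognisable L₂ → Recognisable (λ w → L₁ w × L₂ w)
recognisable-∩ = recognisable-product _×-dec_ _×-⇔_

Contains : (A → Set) → Language A
Contains C w = ∃ λ u → ∃ λ a → ∃ λ v → w ≡ u ++ a ∷ v × C a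

recognisable-Contains : {C : A → Set} → Decidable C → Recognisable (Contains C)
recognisable-Contains {A} {C} C? = M , λ w → ⇔-trans (nothing-seen w) (characterise M Sem base seen-step false w)
  where
    M : Automaton A
    M = record { State = Bool ; finite = finite-Bool ; start = false
               ; step = λ seen a → seen ∨ isYes (C? a) ; Final = T ; final? = T? }

    Sem : Bool → Language A
    Sem seen w = T seen ⊎ Contains C w

    nothing-seen : ∀ w → Contains C w ⇔ Sem false w
    nothing-seen w = mk⇔ inj₂ [ (λ ()) , id ]

    base : ∀ seen → Sem seen [] ⇔ T seen
    base seen = mk⇔ [ id , (λ { ([] , _ , _ , () , _) ; (_ ∷ _ , _ , _ , () , _) }) ] inj₁

    seen-step : ∀ seen a w → Sem seen (a ∷ w) ⇔ Sem (seen ∨ isYes (C? a)) w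
    seen-step seen a w = mk⇔ forward backward
      where
        seen-or-C : T (seen ∨ isYes (C? a)) ⇔ (T seen ⊎ C a)
        seen-or-C = ⇔-trans T-∨ (⇔-refl ⊎-⇔ mk⇔ toWitness fromWitness)

        forward : Sem seen (a ∷ w) → Sem (seen ∨ isYes (C? a)) w
        forward (inj₁ t)                          = inj₁ (from seen-or-C (inj₁ t))
        forward (inj₂ ([] , _ , _ , refl , c))    = inj₁ (from seen-or-C (inj₂ c))
        forward (inj₂ (_ ∷ u , b , v , refl , c)) = inj₂ (u , b , v , refl , c)

        backward : Sem (seen ∨ isYes (C? a)) w → Sem seen (a ∷ w)
        backward (inj₁ t) with to seen-or-C t
        ... | inj₁ t′ = inj₁ t′
        ... | inj₂ c  = inj₂ ([] , a , w , refl , c)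
        backward (inj₂ (u , b , v , refl , c)) = inj₂ (a ∷ u , b , v , refl , c)

-- Reachability in an automaton over a finite alphabet is decidable: a state in
-- a decidable set P is reachable from s iff it is reachable by a word of length
-- at most the number of states, and those words can be searched exhaustively.
module Reachability {k : ℕ} (M : Automaton (Fin k)) where
  open Automaton M
  open FiniteSet finite

  Reaches : (State → Set) → State → Set
  Reaches P s = ∃ λ w → P (run s w)

  -- Pigeonhole: a run longer than the number of states passes twice through
  -- some state, and cutting out the loop between them keeps the final state.
  cut-loop : ∀ s w → size < length w → ∃ λ w′ → length w′ < length w × run s w′ ≡ run s w
  cut-loop s w long with pigeonhole (n<1+n size) (λ i → code (run s (take (toℕ i) w)))
  ... | i , j , i<j , same-code = take (toℕ i) w ++ drop (toℕ j) w , shorter , same-end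
    where
      len = length w

      j≤len : toℕ j ≤ len
      j≤len = ≤-trans (toℕ≤pred[n] j) (<⇒≤ long)

      same-end : run s (take (toℕ i) w ++ drop (toℕ j) w) ≡ run s w
      same-end = begin
          run s (take (toℕ i) w ++ drop (toℕ j) w)
        ≡⟨ foldl-++ step s (take (toℕ i) w) (drop (toℕ j) w) ⟩
          run (run s (take (toℕ i) w)) (drop (toℕ j) w)
        ≡⟨ cong (λ q → run q (drop (toℕ j) w)) (code-injective same-code) ⟩
          run (run s (take (toℕ j) w)) (drop (toℕ j) w)
        ≡⟨ sym (foldl-++ step s (take (toℕ j) w) (drop (toℕ j) w)) ⟩
          run s (take (toℕ j) w ++ drop (toℕ j) w)
        ≡⟨ cong (run s) (take++drop≡id (toℕ j) w) ⟩
          run s w ∎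
        where open ≡-Reasoning

      shorter : length (take (toℕ i) w ++ drop (toℕ j) w) < len
      shorter = begin-strict
          length (take (toℕ i) w ++ drop (toℕ j) w)
        ≡⟨ length-++ (take (toℕ i) w) ⟩
          length (take (toℕ i) w) + length (drop (toℕ j) w)
        ≡⟨ cong₂ _+_ (length-take (toℕ i) w) (length-drop (toℕ j) w) ⟩
          toℕ i ⊓ len + (len ∸ toℕ j)
        ≤⟨ +-monoˡ-≤ (len ∸ toℕ j) (m⊓n≤m (toℕ i) len) ⟩
          toℕ i + (len ∸ toℕ j)
        <⟨ +-monoˡ-< (len ∸ toℕ j) i<j ⟩
          toℕ j + (len ∸ toℕ j)
        ≡⟨ m+[n∸m]≡n j≤len ⟩
          len ∎
        where open ≤-Reasoning

  module _ {P : State → Set} (P? : Decidable P) where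

    ReachesWithin : ℕ → State → Set
    ReachesWithin n s = ∃ λ w → length w ≤ n × P (run s w)

    within? : ∀ n → Decidable (ReachesWithin n)
    within? zero s = map′ (λ p → [] , z≤n , p) (λ { ([] , _ , p) → p ; (_ ∷ _ , () , _) }) (P? s)
    within? (suc n) s = map′ into outof (P? s ⊎-dec any? (λ a → within? n (step s a)))
      where
        into : P s ⊎ ∃ (λ a → ReachesWithin n (step s a)) → ReachesWithin (suc n) s
        into (inj₁ p)               = [] , z≤n , p
        into (inj₂ (a , w , le , p)) = a ∷ w , s≤s le , p

        outof : ReachesWithin (suc n) s → P s ⊎ ∃ (λ a → ReachesWithin n (step s a))
        outof ([] , _ , p)           = inj₁ p
        outof (a ∷ w , s≤s le , p)   = inj₂ (a , w , le , p)

    -- Repeated loop cutting; the recursion is on an upper bound for length w.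
    shorten : ∀ bound s w → length w ≤ bound → P (run s w) → ReachesWithin size s
    shorten bound s w len≤ p with length w ≤? size
    ... | yes short = w , short , p
    shorten zero        s w len≤ p | no long = w , ≤-trans len≤ z≤n , p
    shorten (suc bound) s w len≤ p | no long with cut-loop s w (≰⇒> long)
    ... | w′ , shorter , same = shorten bound s w′ (<⇒≤pred (<-≤-trans shorter len≤)) (subst P (sym same) p)

    reaches? : Decidable (Reaches P)
    reaches? s = map′ (λ (w , _ , p) → w , p) (λ (w , p) → shorten (length w) s w ≤-refl p) (within? size s)

Occurs : Language A → A → Set
Occurs L a = ∃ λ u → ∃ λ v → L (u ++ a ∷ v)

occurs? : {k : ℕ} {L : Language (Fin k)} → Recognisable L → Decidable (Occurs L)
occurs? {k} {L} (M , L⇔M) a =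
  map′ witness occurrence (∃? λ p → reaches? (_≟ p) start ×-dec reaches? final? (step p a))
  where
    open Automaton M
    open FiniteSet finite
    open Reachability M

    witness : ∃ (λ p → Reaches (_≡ p) start × Reaches Final (step p a)) → Occurs L a
    witness (p , (u , refl) , (v , final)) = u , v , from (L⇔M _) (from (From-++ start u (a ∷ v)) final)

    occurrence : Occurs L a → ∃ (λ p → Reaches (_≡ p) start × Reaches Final (step p a))
    occurrence (u , v , l) = run start u , (u , refl) , v , to (From-++ start u (a ∷ v)) (to (L⇔M _) l)

Cross : Language A → Language A → Language A
Cross L₁ L₂ w = ∃ λ u → ∃ λ a → ∃ λ v → w ≡ u ++ a ∷ v ×
                (∃ λ v₁ → L₁ (u ++ a ∷ v₁)) × (∃ λ u₂ → L₂ (u₂ ++ a ∷ v))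

-- The automaton for Cross runs M₁ and keeps the set of M₂-states from which
-- the rest of the word must be accepted, for all splice points guessed so far.
module CrossAutomaton {k : ℕ} (M₁ M₂ : Automaton (Fin k)) where
  module A₁ = Automaton M₁
  module A₂ = Automaton M₂
  open Reachability M₁ using () renaming (Reaches to Reaches₁; reaches? to reaches₁?)
  open Reachability M₂ using () renaming (Reaches to Reaches₂; reaches? to reaches₂?)
  open FiniteSet A₂.finite

  Subset : Set
  Subset = Vec Bool size

  _∈_ : A₂.State → Subset → Set
  r ∈ V = T (lookup V (code r))

  _∈?_ : ∀ r V → Dec (r ∈ V)
  r ∈? V = T? (lookup V (code r))

  ⟦_⟧ : {P : A₂.State → Set} → Decidable P → Subset
  ⟦ P? ⟧ = tabulate (λ i → isYes (P? (decode i)))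

  ∈⟦⟧ : {P : A₂.State → Set} (P? : Decidable P) (r : A₂.State) → r ∈ ⟦ P? ⟧ ⇔ P r
  ∈⟦⟧ P? r rewrite lookup∘tabulate (λ i → isYes (P? (decode i))) (code r) | decode-code r =
    mk⇔ toWitness fromWitness

  nothing? : Decidable (λ (_ : A₂.State) → ⊥)
  nothing? _ = no id

  ∅ : Subset
  ∅ = ⟦ nothing? ⟧

  -- After reading b in state q with pending set V, an M₂-state p must be
  -- followed on b if it was pending, or if a splice at b is possible: the
  -- M₁-run can still be completed and p is reachable in M₂.
  Pending : A₁.State → Subset → Fin k → A₂.State → Set
  Pending q V b p = p ∈ V ⊎ (Reaches₁ A₁.Final (A₁.step q b) × Reaches₂ (_≡ p) A₂.start)

  pending? : ∀ q V b → Decidable (Pending q V b)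
  pending? q V b p = (p ∈? V) ⊎-dec (reaches₁? A₁.final? (A₁.step q b) ×-dec reaches₂? (_≟ p) A₂.start)

  Next : A₁.State → Subset → Fin k → A₂.State → Set
  Next q V b r = ∃ λ p → Pending q V b p × A₂.step p b ≡ r

  next? : ∀ q V b → Decidable (Next q V b)
  next? q V b r = ∃? λ p → pending? q V b p ×-dec (A₂.step p b ≟ r)

  M : Automaton (Fin k)
  M = record { State = A₁.State × Subset ; finite = finite-× A₁.finite (finite-Vec finite-Bool size)
             ; start = A₁.start , ∅
             ; step = λ qV b → A₁.step (proj₁ qV) b , ⟦ next? (proj₁ qV) (proj₂ qV) b ⟧
             ; Final = λ qV → ∃ λ r → r ∈ proj₂ qV × A₂.Final r
             ; final? = λ qV → ∃? λ r → (r ∈? proj₂ qV) ×-dec A₂.final? r }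

  Splice : A₁.State → Language (Fin k)
  Splice q w = ∃ λ u → ∃ λ a → ∃ λ v → w ≡ u ++ a ∷ v × (∃ λ v₁ → A₁.From q (u ++ a ∷ v₁)) ×
               (∃ λ p → Reaches₂ (_≡ p) A₂.start × A₂.From (A₂.step p a) v)

  -- The language of state (q, V): finish in M₂ from a pending state, or splice later.
  Sem : A₁.State × Subset → Language (Fin k)
  Sem (q , V) w = (∃ λ r → r ∈ V × A₂.From r w) ⊎ Splice q w

  sem-[] : ∀ qV → Sem qV [] ⇔ Automaton.Final M qV
  sem-[] qV = mk⇔ [ id , (λ { ([] , _ , _ , () , _) ; (_ ∷ _ , _ , _ , () , _) }) ] inj₁

  sem-step : ∀ qV b w → Sem qV (b ∷ w) ⇔ Sem (Automaton.step M qV b) w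
  sem-step (q , V) b w = mk⇔ forward backward
    where
      forward : Sem (q , V) (b ∷ w) → Sem (Automaton.step M (q , V) b) w
      forward (inj₁ (r , r∈V , acc)) =
        inj₁ (A₂.step r b , from (∈⟦⟧ (next? q V b) _) (r , inj₁ r∈V , refl) , acc)
      forward (inj₂ ([] , _ , _ , refl , co , p , reach , acc)) =
        inj₁ (A₂.step p b , from (∈⟦⟧ (next? q V b) _) (p , inj₂ (co , reach) , refl) , acc)
      forward (inj₂ (_ ∷ u , a , v , refl , rest)) = inj₂ (u , a , v , refl , rest)

      backward : Sem (Automaton.step M (q , V) b) w → Sem (q , V) (b ∷ w)
      backward (inj₁ (r , r∈next , acc)) with to (∈⟦⟧ (next? q V b) r) r∈next
      ... | p , inj₁ p∈V , refl = inj₁ (p , p∈V , acc)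
      ... | p , inj₂ (co , reach) , refl = inj₂ ([] , b , w , refl , co , p , reach , acc)
      backward (inj₂ (u , a , v , refl , rest)) = inj₂ (b ∷ u , a , v , refl , rest)

  accepts-Splice : ∀ w → Splice A₁.start w ⇔ Automaton.From M (A₁.start , ∅) w
  accepts-Splice w = ⇔-trans (mk⇔ inj₂ [ (λ (r , r∈∅ , _) → ⊥-elim (to (∈⟦⟧ nothing? r) r∈∅)) , id ])
                             (characterise M Sem sem-[] sem-step (A₁.start , ∅) w)

-- From M₁'s start state, splicing is exactly Cross L₁ L₂: the prefix condition is
-- L₁-acceptance, and reaching p after u₂ turns M₂-acceptance of a v into L₂(u₂ a v).
recognisable-Cross : {k : ℕ} {L₁ L₂ : Language (Fin k)} →
                     Recognisable L₁ → Recognisable L₂ → Recognisable (Cross L₁ L₂)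
recognisable-Cross {L₁ = L₁} {L₂} (M₁ , L₁⇔M₁) (M₂ , L₂⇔M₂) = M , λ w → ⇔-trans (cross⇔splice w) (accepts-Splice w)
  where
    open CrossAutomaton M₁ M₂
    cross⇔splice : ∀ w → Cross L₁ L₂ w ⇔ Splice A₁.start w
    cross⇔splice w = mk⇔
      (λ (u , a , v , eq , (v₁ , l₁) , (u₂ , l₂)) →
         u , a , v , eq , (v₁ , to (L₁⇔M₁ (u ++ a ∷ v₁)) l₁) ,
         (A₂.run A₂.start u₂ , (u₂ , refl) , to (A₂.From-++ A₂.start u₂ (a ∷ v)) (to (L₂⇔M₂ (u₂ ++ a ∷ v)) l₂)))
      (λ { (u , a , v , eq , (v₁ , f₁) , (_ , (u₂ , refl) , f₂)) →
         u , a , v , eq , (v₁ , from (L₁⇔M₁ (u ++ a ∷ v₁)) f₁) ,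
         (u₂ , from (L₂⇔M₂ (u₂ ++ a ∷ v)) (from (A₂.From-++ A₂.start u₂ (a ∷ v)) f₂)) })

GSACases : Language A → Language A → Language A
GSACases L₁ L₂ w = (L₁ w × Contains (Occurs L₂) w) ⊎ (L₂ w × Contains (Occurs L₁) w) ⊎
                   Cross L₁ L₂ w ⊎ Cross L₂ L₁ w

gsa-from-cases : ∀ w → GSACases L₁ L₂ w → GSA L₁ L₂ w
gsa-from-cases w (inj₁ (l , u , a , v , ew , u₂ , v₂ , l₂)) =
  w , u₂ ++ a ∷ v₂ , l , l₂ , u , a ∷ [] , v , u₂ , v₂ , (λ ()) , ew , refl , inj₁ ew
gsa-from-cases w (inj₂ (inj₁ (l , u , a , v , ew , u₁ , v₁ , l₁))) =
  u₁ ++ a ∷ v₁ , w , l₁ , l , u₁ , a ∷ [] , v₁ , u , v , (λ ()) , refl , ew , inj₂ (inj₁ ew)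
gsa-from-cases w (inj₂ (inj₂ (inj₁ (u , a , v , ew , (v₁ , l₁) , (u₂ , l₂))))) =
  u ++ a ∷ v₁ , u₂ ++ a ∷ v , l₁ , l₂ , u , a ∷ [] , v₁ , u₂ , v , (λ ()) , refl , refl , inj₂ (inj₂ (inj₁ ew))
gsa-from-cases w (inj₂ (inj₂ (inj₂ (u , a , v , ew , (v₂ , l₂) , (u₁ , l₁))))) =
  u₁ ++ a ∷ v , u ++ a ∷ v₂ , l₁ , l₂ , u₁ , a ∷ [] , v , u , v₂ , (λ ()) , refl , refl , inj₂ (inj₂ (inj₂ ew))

-- A splice along a nonempty factor a ∷ y is a splice along its first letter a,
-- with y moved into the surrounding suffixes.
gsa-to-cases : ∀ w → GSA L₁ L₂ w → GSACases L₁ L₂ w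
gsa-to-cases w (_ , _ , _ , _ , _ , [] , _ , _ , _ , nonempty , _) = ⊥-elim (nonempty refl)
gsa-to-cases {L₁ = L₁} {L₂ = L₂} w (_ , _ , l₁ , l₂ , u₁ , a ∷ y , v₁ , u₂ , v₂ , _ , refl , refl , choice) with choice
... | inj₁ ew =
  inj₁ (subst L₁ (sym ew) l₁ , u₁ , a , y ++ v₁ , ew , u₂ , y ++ v₂ , l₂)
... | inj₂ (inj₁ ew) =
  inj₂ (inj₁ (subst L₂ (sym ew) l₂ , u₂ , a , y ++ v₂ , ew , u₁ , y ++ v₁ , l₁))
... | inj₂ (inj₂ (inj₁ ew)) =
  inj₂ (inj₂ (inj₁ (u₁ , a , y ++ v₂ , ew , (y ++ v₁ , l₁) , (u₂ , l₂))))
... | inj₂ (inj₂ (inj₂ ew)) =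
  inj₂ (inj₂ (inj₂ (u₂ , a , y ++ v₁ , ew , (y ++ v₂ , l₂) , (u₁ , l₁))))

theorem5 : {k : ℕ} (L₁ L₂ : Language (Fin k)) → Regular L₁ → Regular L₂ → Regular (GSA L₁ L₂)
theorem5 {k} L₁ L₂ R₁ R₂ =
  recognisable⇒regular (recognisable-⇔ (λ w → mk⇔ (gsa-from-cases w) (gsa-to-cases w)) cases)
  where
    M₁ : Recognisable L₁
    M₁ = regular⇒recognisable R₁

    M₂ : Recognisable L₂
    M₂ = regular⇒recognisable R₂

    letter-case : ∀ {L L′ : Language (Fin k)} → Recognisable L → Recognisable L′ →
                  Recognisable (λ w → L w × Contains (Occurs L′) w)
    letter-case M M′ = recognisable-∩ M (recognisable-Contains (occurs? M′))

    cases : Recognisable (GSACases L₁ L₂)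
    cases = recognisable-∪ (letter-case M₁ M₂)
              (recognisable-∪ (letter-case M₂ M₁)
                (recognisable-∪ (recognisable-Cross M₁ M₂) (recognisable-Cross M₂ M₁)))
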